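{- For every duplicative forest $\mathfrak{f}$, the poset $\mathcal{D}^*(\mathfrak{f})$ is isomorphic to a maximal interval of a Mockingbird lattice, that is, there exist $d\ge 0$ and an element $\mathfrak{u}$ of $\mathrm{M}(d)$ such that $\mathcal{D}^*(\mathfrak{f})$ is isomorphic to the interval $[\mathfrak{u},\mathfrak{v}]$ of $\mathrm{M}(d)$, where $\mathfrak{v}$ is the greatest element of $\mathrm{M}(d)$.
   Context: A duplicative tree is a planar rooted tree each of whose nodes is white or black; a duplicative forest is a finite word of duplicative trees. For a forest $\mathfrak{g}$, $\circ(\mathfrak{g})$ (resp. $\bullet(\mathfrak{g})$) is the tree with white (resp. black) root and subtree sequence $\mathfrak{g}$; concatenation is written $\mathfrak{g}\mathfrak{g}'$. $\mathfrak{f}\Rightarrow_{\mathcal{D}}\mathfrak{f}'$ if $\mathfrak{f}'$ is obtained from $\mathfrak{f}$ by choosing a white node with subtree $\circ(\mathfrak{g})$ and replacing it by $\bullet(\mathfrak{g}\mathfrak{g})$; $\ll$ is the reflexive-transitive closure (a partial order) and $\mathcal{D}^*(\mathfrak{f})$ is $\{\mathfrak{f}' : \mathfrak{f}\ll\mathfrak{f}'\}$ ordered by $\ll$. Terms over $\{{\rm M}\}$: smallest set containing variables $\mathsf{x}_1,\mathsf{x}_2,\dots$, the symbol ${\rm M}$, and $(\mathfrak{t}_1\mathfrak{t}_2)$ (application associates to the left). $\Rightarrow$ is the smallest relation with ${\rm M}\,\mathfrak{s}\Rightarrow\mathfrak{s}\,\mathfrak{s}$ for all terms $\mathfrak{s}$,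 closed under $\mathfrak{t}_1\Rightarrow\mathfrak{t}_1'$ implies $\mathfrak{t}_1\mathfrak{t}_2\Rightarrow\mathfrak{t}_1'\mathfrak{t}_2$ and $\mathfrak{t}_2\mathfrak{t}_1\Rightarrow\mathfrak{t}_2\mathfrak{t}_1'$; $\preccurlyeq$ is its reflexive-transitive closure (a partial order). Let $\mathfrak{r}_0 = {\rm M}$ and $\mathfrak{r}_d = {\rm M}\,\mathfrak{r}_{d-1}$ for $d\ge1$. The Mockingbird lattice of order $d$ is $\mathrm{M}(d) = \{\mathfrak{t} : \mathfrak{r}_d\preccurlyeq\mathfrak{t}\}$ ordered by $\preccurlyeq$; it is a finite lattice. A maximal interval of a lattice is an interval whose upper bound is the greatest element of the lattice. -}

module Defs where

open import Data.Nat using (ℕ; zero; suc)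
open import Data.List using (List; []; _∷_; _++_)
open import Data.Product using (Σ; _×_; proj₁)
open import Relation.Binary.PropositionalEquality using (_≡_)
open import Relation.Binary.Construct.Closure.ReflexiveTransitive using (Star)

data DTree : Set where
  white : List DTree → DTree
  black : List DTree → DTree

DForest : Set
DForest = List DTree

mutual
  data _⇒T_ : DTree → DTree → Set where
    dup    : ∀ {g} → white g ⇒T black (g ++ g)
    inside-white : ∀ {g g'} → g ⇒D g' → white g ⇒T white g'
    inside-black : ∀ {g g'} → g ⇒D g' → black g ⇒T black g'

  data _⇒D_ : DForest → DForest → Set where
    here  : ∀ {t t' g} → t ⇒T t' → (t ∷ g) ⇒D (t' ∷ g)
    there : ∀ {t g g'} → g ⇒D g' → (t ∷ g) ⇒D (t ∷ g')

_≪_ : DForest → DForest → Set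
_≪_ = Star _⇒D_

D* : DForest → Set
D* f = Σ DForest (λ f' → f ≪ f')

infixl 9 _·_
data Term : Set where
  var : ℕ → Term
  M   : Term
  _·_ : Term → Term → Term

data _⇒_ : Term → Term → Set where
  dupM : ∀ {s} → (M · s) ⇒ (s · s)
  appL : ∀ {t₁ t₁' t₂} → t₁ ⇒ t₁' → (t₁ · t₂) ⇒ (t₁' · t₂)
  appR : ∀ {t₁ t₁' t₂} → t₁ ⇒ t₁' → (t₂ · t₁) ⇒ (t₂ · t₁')

_≼_ : Term → Term → Set
_≼_ = Star _⇒_

r : ℕ → Term
r zero    = M
r (suc d) = M · r d

InM : ℕ → Term → Set
InM d t = r d ≼ t

IsGreatestM : ℕ → Term → Set
IsGreatestM d v = InM d v × (∀ t → InM d t → t ≼ v)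

Interval : Term → Term → Set
Interval u v = Σ Term (λ t → u ≼ t × t ≼ v)

record OrderIso (f : DForest) (u v : Term) : Set where
  field
    to      : D* f → Interval u v
    from    : Interval u v → D* f
    to-from : ∀ x → proj₁ (to (from x)) ≡ proj₁ x
    from-to : ∀ x → proj₁ (from (to x)) ≡ proj₁ x
    to-mono : ∀ x y → proj₁ x ≪ proj₁ y → proj₁ (to x) ≼ proj₁ (to y)
    to-refl : ∀ x y → proj₁ (to x) ≼ proj₁ (to y) → proj₁ x ≪ proj₁ y

-- A forest reachable from f arises from f by duplicating white nodes, so it can
-- be described relative to the shape of f.  It is encoded as a term of M(k):
-- a forest t₁ … tₙ becomes the right comb  enc t₁ · (… · (enc tₙ · top k)),  a
-- white node ∘(g) becomes M · enc g, a node •(x y) produced by duplicating ∘(g)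
-- becomes enc x · enc y, and a black node •(g) of f becomes enc g · top.  As the
-- top element only rewrites to itself, the rewrite steps of an encoding are
-- exactly the images of duplications, and the encoding is injective; so it is an
-- order isomorphism from D*(f) onto the interval above the encoding of f.
module Submission where

open import Defs
open import Data.Nat using (ℕ; zero; suc; _⊔_; _≤′_; ≤′-refl; ≤′-step)
open import Data.Nat.Properties using (m≤m⊔n; m≤n⊔m; ≤⇒≤′)
open import Data.Product using (Σ; ∃-syntax; _×_; _,_; proj₁; proj₂; uncurry)
import Data.Product as Product
open import Data.Unit using (⊤; tt)
open import Data.Empty using (⊥; ⊥-elim)
open import Data.List using (List; []; _∷_; _++_; length; splitAt)
open import Data.List.Relation.Binary.Pointwise using (Pointwise; []; _∷_; Pointwise-length)
open import Function using (_∘_; id)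
open import Relation.Binary.PropositionalEquality
open import Relation.Binary.Construct.Closure.ReflexiveTransitive using (Star; ε; _◅_; _◅◅_; gmap)

private
  variable
    k : ℕ
    a a′ b b′ s t t′ u : Term
    g h x x′ y y′ : DForest
    p q q′ : DTree

·-injective : a · b ≡ a′ · b′ → a ≡ a′ × b ≡ b′
·-injective refl = refl , refl

·-monoˡ-≼ : a ≼ a′ → (a · b) ≼ (a′ · b)
·-monoˡ-≼ = gmap _ appL

·-monoʳ-≼ : b ≼ b′ → (a · b) ≼ (a · b′)
·-monoʳ-≼ = gmap _ appR

·-mono-≼ : a ≼ a′ → b ≼ b′ → (a · b) ≼ (a′ · b′)
·-mono-≼ a≼a′ b≼b′ = ·-monoˡ-≼ a≼a′ ◅◅ ·-monoʳ-≼ b≼b′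

data ·-Step (a b : Term) : Term → Set where
  root  : a ≡ M → ·-Step a b (b · b)
  left  : a ⇒ a′ → ·-Step a b (a′ · b)
  right : b ⇒ b′ → ·-Step a b (a · b′)

·-step : (a · b) ⇒ u → ·-Step a b u
·-step dupM     = root refl
·-step (appL s) = left s
·-step (appR s) = right s

data Level : ℕ → Term → Set where
  M-level  : Level 0 M
  M·-level : Level k s → Level (suc k) (M · s)
  ·-level  : Level k a → Level k b → Level (suc k) (a · b)

top : ℕ → Term
top zero    = M
top (suc k) = top k · top k

r-Level : ∀ k → Level k (r k)
r-Level zero    = M-level
r-Level (suc k) = M·-level (r-Level k)

top-Level : ∀ k → Level k (top k)
top-Level zero    = M-level
top-Level (suc k) = ·-level (top-Level k) (top-Level k)

Level⇒InM : Level k t → InM k t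
Level⇒InM M-level       = ε
Level⇒InM (M·-level l)  = ·-monoʳ-≼ (Level⇒InM l)
Level⇒InM (·-level l m) = dupM ◅ ·-mono-≼ (Level⇒InM l) (Level⇒InM m)

Level-⇒ : Level k t → t ⇒ t′ → Level k t′
Level-⇒ (M·-level l)  dupM     = ·-level l l
Level-⇒ (·-level l m) dupM     = ·-level m m
Level-⇒ (M·-level l)  (appL ())
Level-⇒ (·-level l m) (appL s) = ·-level (Level-⇒ l s) m
Level-⇒ (M·-level l)  (appR s) = M·-level (Level-⇒ l s)
Level-⇒ (·-level l m) (appR s) = ·-level l (Level-⇒ m s)

Level-≼ : Level k t → t ≼ t′ → Level k t′
Level-≼ l ε        = l
Level-≼ l (s ◅ ss) = Level-≼ (Level-⇒ l s) ss

InM⇒Level : InM k t → Level k t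
InM⇒Level {k} = Level-≼ (r-Level k)

Level⇒≼top : Level k t → t ≼ top k
Level⇒≼top M-level       = ε
Level⇒≼top (M·-level l)  = dupM ◅ ·-mono-≼ (Level⇒≼top l) (Level⇒≼top l)
Level⇒≼top (·-level l m) = ·-mono-≼ (Level⇒≼top l) (Level⇒≼top m)

top-greatest : ∀ k → IsGreatestM k (top k)
top-greatest k = Level⇒InM (top-Level k) , λ _ → Level⇒≼top ∘ InM⇒Level

top-⇒ : ∀ k → top k ⇒ t → t ≡ top k
top-⇒ (suc zero)    dupM     = refl
top-⇒ (suc zero)    (appL ())
top-⇒ (suc zero)    (appR ())
top-⇒ (suc (suc k)) (appL s) = cong (_· top (suc k)) (top-⇒ (suc k) s)
top-⇒ (suc (suc k)) (appR s) = cong (top (suc k) ·_) (top-⇒ (suc k) s)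

module Simulation
  {A B : Set} {_↝_ : A → A → Set} {_⇝_ : B → B → Set}
  (Inv : A → Set) (enc : A → B)
  (forward  : ∀ {a a′} → Inv a → a ↝ a′ → Inv a′ × enc a ⇝ enc a′)
  (backward : ∀ {a b} → Inv a → enc a ⇝ b →
              ∃[ a′ ] Star _↝_ a a′ × Inv a′ × enc a′ ≡ b)
  where

  forward* : ∀ {a a′} → Inv a → Star _↝_ a a′ → Inv a′ × Star _⇝_ (enc a) (enc a′)
  forward* i ε        = i , ε
  forward* i (s ◅ ss) =
    let i′ , s′ = forward i s in Product.map₂ (s′ ◅_) (forward* i′ ss)

  backward* : ∀ {a b} → Inv a → Star _⇝_ (enc a) b →
              ∃[ a′ ] Star _↝_ a a′ × Inv a′ × enc a′ ≡ b
  backward* i ε        = _ , ε , i , refl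
  backward* i (s ◅ ss) with backward i s
  ... | _ , ss′ , i′ , refl =
    let a″ , ss″ , i″ , e = backward* i′ ss in a″ , ss′ ◅◅ ss″ , i″ , e

data ++-Step (x y : DForest) : DForest → Set where
  inˡ : x ⇒D x′ → ++-Step x y (x′ ++ y)
  inʳ : y ⇒D y′ → ++-Step x y (x ++ y′)

++-step : ∀ x y → (x ++ y) ⇒D h → ++-Step x y h
++-step []      y s         = inʳ s
++-step (p ∷ x) y (here s)  = inˡ (here s)
++-step (p ∷ x) y (there s) with ++-step x y s
... | inˡ s′ = inˡ (there s′)
... | inʳ s′ = inʳ s′

⇒D-++ˡ : ∀ y → x ⇒D x′ → (x ++ y) ⇒D (x′ ++ y)
⇒D-++ˡ y (here s)  = here s
⇒D-++ˡ y (there s) = there (⇒D-++ˡ y s)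

⇒D-++ʳ : ∀ x → y ⇒D y′ → (x ++ y) ⇒D (x ++ y′)
⇒D-++ʳ []      s = s
⇒D-++ʳ (p ∷ x) s = there (⇒D-++ʳ x s)

splitAt-++ : ∀ {A : Set} (xs ys : List A) → splitAt (length xs) (xs ++ ys) ≡ (xs , ys)
splitAt-++ []       ys = refl
splitAt-++ (x ∷ xs) ys = cong (Product.map₁ (x ∷_)) (splitAt-++ xs ys)

-- FitsT p q: q arises from p by duplications; a node •(x y) produced by
-- duplicating ∘(g) remembers its halves x and y, which develop independently.
data FitsT : DTree → DTree → Set where
  white-fits : Pointwise FitsT g x → FitsT (white g) (white x)
  dup-fits   : Pointwise FitsT g x → Pointwise FitsT g y → FitsT (white g) (black (x ++ y))
  black-fits : Pointwise FitsT g x → FitsT (black g) (black x)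

FitsF : DForest → DForest → Set
FitsF = Pointwise FitsT

mutual
  fitsT-refl : ∀ p → FitsT p p
  fitsT-refl (white g) = white-fits (fitsF-refl g)
  fitsT-refl (black g) = black-fits (fitsF-refl g)

  fitsF-refl : ∀ g → FitsF g g
  fitsF-refl []      = []
  fitsF-refl (p ∷ g) = fitsT-refl p ∷ fitsF-refl g

-- Trees need level at least 2 so that their subforests are encoded at a
-- positive level, where encodings are applications and never M; this keeps
-- M · enc g apart from the encodings of duplicated nodes.
mutual
  EncodableT : ℕ → DTree → Set
  EncodableT (suc (suc k)) (white g) = EncodableF (suc k) g
  EncodableT (suc (suc k)) (black g) = EncodableF (suc k) g
  EncodableT _             _         = ⊥

  EncodableF : ℕ → DForest → Set
  EncodableF _       []      = ⊤
  EncodableF zero    (_ ∷ _) = ⊥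
  EncodableF (suc k) (p ∷ g) = EncodableT k p × EncodableF k g

mutual
  EncodableT-suc : ∀ k p → EncodableT k p → EncodableT (suc k) p
  EncodableT-suc (suc (suc k)) (white g) e = EncodableF-suc (suc k) g e
  EncodableT-suc (suc (suc k)) (black g) e = EncodableF-suc (suc k) g e

  EncodableF-suc : ∀ k g → EncodableF k g → EncodableF (suc k) g
  EncodableF-suc k       []      _        = tt
  EncodableF-suc (suc k) (p ∷ g) (e , e′) = EncodableT-suc k p e , EncodableF-suc k g e′

suc-closed⇒≤′-closed : ∀ (P : ℕ → Set) → (∀ k → P k → P (suc k)) →
                        ∀ {m n} → m ≤′ n → P m → P n
suc-closed⇒≤′-closed P step ≤′-refl       pm = pm
suc-closed⇒≤′-closed P step (≤′-step m≤n) pm = step _ (suc-closed⇒≤′-closed P step m≤n pm)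

mutual
  encodableT : ∀ p → ∃[ k ] EncodableT k p
  encodableT (white g) = let k , e = encodableF g in suc (suc k) , EncodableF-suc k g e
  encodableT (black g) = let k , e = encodableF g in suc (suc k) , EncodableF-suc k g e

  encodableF : ∀ g → ∃[ k ] EncodableF k g
  encodableF []      = 0 , tt
  encodableF (p ∷ g) =
    let m , ep = encodableT p
        n , eg = encodableF g
    in suc (m ⊔ n)
     , suc-closed⇒≤′-closed (λ k → EncodableT k p) (λ k → EncodableT-suc k p)
         (≤⇒≤′ (m≤m⊔n m n)) ep
     , suc-closed⇒≤′-closed (λ k → EncodableF k g) (λ k → EncodableF-suc k g)
         (≤⇒≤′ (m≤n⊔m m n)) eg

-- The catch-all clauses are junk, never reached under EncodableT and FitsT.
mutual
  encT : ℕ → DTree → DTree → Term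
  encT (suc (suc k)) (white g) (white x) = M · encF (suc k) g x
  encT (suc (suc k)) (white g) (black h) =
    uncurry (λ x y → encF (suc k) g x · encF (suc k) g y) (splitAt (length g) h)
  encT (suc (suc k)) (black g) (black h) = encF (suc k) g h · top (suc k)
  encT k             _         _         = top k

  encF : ℕ → DForest → DForest → Term
  encF (suc k) (p ∷ g) (q ∷ x) = encT k p q · encF k g x
  encF k       _       _       = top k

encT-dup : FitsF g x → FitsF g y →
           encT (suc (suc k)) (white g) (black (x ++ y)) ≡ encF (suc k) g x · encF (suc k) g y
encT-dup {x = x} {y = y} fx _ rewrite Pointwise-length fx | splitAt-++ x y = refl

encF-≢M : ∀ k g x → encF (suc k) g x ≢ M
encF-≢M k []      _       ()
encF-≢M k (_ ∷ _) []      ()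
encF-≢M k (_ ∷ _) (_ ∷ _) ()

encT-≢M : ∀ k p q → EncodableT k p → encT k p q ≢ M
encT-≢M (suc (suc k)) (white g) (white x) _ ()
encT-≢M (suc (suc k)) (white g) (black h) _ ()
encT-≢M (suc (suc k)) (black g) (white x) _ ()
encT-≢M (suc (suc k)) (black g) (black h) _ ()

mutual
  encT-Level : EncodableT k p → FitsT p q → Level k (encT k p q)
  encT-Level {suc (suc k)} e (white-fits fx) = M·-level (encF-Level e fx)
  encT-Level {suc (suc k)} e (dup-fits fx fy) rewrite encT-dup {k = k} fx fy =
    ·-level (encF-Level e fx) (encF-Level e fy)
  encT-Level {suc (suc k)} e (black-fits fx) = ·-level (encF-Level e fx) (top-Level (suc k))

  encF-Level : EncodableF k g → FitsF g x → Level k (encF k g x)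
  encF-Level {zero}  _        []        = M-level
  encF-Level {suc k} _        []        = top-Level (suc k)
  encF-Level {suc k} (e , e′) (fp ∷ fg) = ·-level (encT-Level e fp) (encF-Level e′ fg)

encT-dup-⇒ : (fx : FitsF g x) (fy : FitsF g y) (fx′ : FitsF g x′) (fy′ : FitsF g y′) →
             (encF (suc k) g x · encF (suc k) g y) ⇒ (encF (suc k) g x′ · encF (suc k) g y′) →
             encT (suc (suc k)) (white g) (black (x ++ y))
               ⇒ encT (suc (suc k)) (white g) (black (x′ ++ y′))
encT-dup-⇒ {k = k} fx fy fx′ fy′
  rewrite encT-dup {k = k} fx fy | encT-dup {k = k} fx′ fy′ = id

mutual
  encT-forward : EncodableT k p → FitsT p q → q ⇒T q′ →
                 FitsT p q′ × encT k p q ⇒ encT k p q′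
  encT-forward {suc (suc k)} e (white-fits fx) dup rewrite encT-dup {k = k} fx fx =
    dup-fits fx fx , dupM
  encT-forward {suc (suc k)} e (white-fits fx) (inside-white s) =
    Product.map white-fits appR (encF-forward e fx s)
  encT-forward {suc (suc k)} e (dup-fits {x = x} {y = y} fx fy) (inside-black s)
    with ++-step x y s
  ... | inˡ s′ = let fx′ , st = encF-forward e fx s′ in
                 dup-fits fx′ fy , encT-dup-⇒ fx fy fx′ fy (appL st)
  ... | inʳ s′ = let fy′ , st = encF-forward e fy s′ in
                 dup-fits fx fy′ , encT-dup-⇒ fx fy fx fy′ (appR st)
  encT-forward {suc (suc k)} e (black-fits fx) (inside-black s) =
    Product.map black-fits appL (encF-forward e fx s)

  encF-forward : EncodableF k g → FitsF g x → x ⇒D x′ →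
                 FitsF g x′ × encF k g x ⇒ encF k g x′
  encF-forward {suc k} (e , e′) (fp ∷ fg) (here s)  =
    Product.map (_∷ fg) appL (encT-forward {k} e fp s)
  encF-forward {suc k} (e , e′) (fp ∷ fg) (there s) =
    Product.map (fp ∷_) appR (encF-forward e′ fg s)

mutual
  encT-backward : EncodableT k p → FitsT p q → encT k p q ⇒ u →
                  ∃[ q′ ] Star _⇒T_ q q′ × FitsT p q′ × encT k p q′ ≡ u
  encT-backward {suc (suc k)} e (white-fits fx) st with ·-step st
  ... | root _    = _ , dup ◅ ε , dup-fits fx fx , encT-dup fx fx
  ... | left ()
  ... | right st′ =
    let x′ , ss , fx′ , eq = encF-backward e fx st′ in
    white x′ , gmap _ inside-white ss , white-fits fx′ , cong (M ·_) eq
  encT-backward {suc (suc k)} {u = u} e (dup-fits {g} {x} {y} fx fy) st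
    with ·-step (subst (_⇒ u) (encT-dup fx fy) st)
  ... | root eq   = ⊥-elim (encF-≢M k g x eq)
  ... | left st′  =
    let x′ , ss , fx′ , eq = encF-backward e fx st′ in
    black (x′ ++ y) , gmap _ (inside-black ∘ ⇒D-++ˡ y) ss , dup-fits fx′ fy ,
    trans (encT-dup fx′ fy) (cong (_· _) eq)
  ... | right st′ =
    let y′ , ss , fy′ , eq = encF-backward e fy st′ in
    black (x ++ y′) , gmap _ (inside-black ∘ ⇒D-++ʳ x) ss , dup-fits fx fy′ ,
    trans (encT-dup fx fy′) (cong (_ ·_) eq)
  encT-backward {suc (suc k)} e (black-fits {g} {x} fx) st with ·-step st
  ... | root eq   = ⊥-elim (encF-≢M k g x eq)
  ... | left st′  =
    let x′ , ss , fx′ , eq = encF-backward e fx st′ in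
    black x′ , gmap _ inside-black ss , black-fits fx′ , cong (_· _) eq
  ... | right st′ = _ , ε , black-fits fx , cong (_ ·_) (sym (top-⇒ (suc k) st′))

  encF-backward : EncodableF k g → FitsF g x → encF k g x ⇒ u →
                  ∃[ x′ ] x ≪ x′ × FitsF g x′ × encF k g x′ ≡ u
  encF-backward {zero}  _ [] ()
  encF-backward {suc k} _ [] st = _ , ε , [] , sym (top-⇒ (suc k) st)
  encF-backward {suc k} (e , e′) (_∷_ {x = p} {y = q} fp fg) st with ·-step st
  ... | root eq   = ⊥-elim (encT-≢M k p q e eq)
  ... | left st′  =
    let q′ , ss , fq′ , eq = encT-backward {k} e fp st′ in
    _ , gmap _ here ss , fq′ ∷ fg , cong (_· _) eq
  ... | right st′ =
    let x′ , ss , fx′ , eq = encF-backward e′ fg st′ in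
    _ , gmap _ there ss , fp ∷ fx′ , cong (_ ·_) eq

mutual
  encT-injective : EncodableT k p → FitsT p q → FitsT p q′ → encT k p q ≡ encT k p q′ → q ≡ q′
  encT-injective {suc (suc k)} e (white-fits fx) (white-fits fx′) eq =
    cong white (encF-injective e fx fx′ (proj₂ (·-injective eq)))
  encT-injective {suc (suc k)} e (white-fits fx) (dup-fits {g} {x} fy fz) eq =
    ⊥-elim (encF-≢M k g x (sym (proj₁ (·-injective (trans eq (encT-dup fy fz))))))
  encT-injective {suc (suc k)} e (dup-fits {g} {x} fx fy) (white-fits fz) eq =
    ⊥-elim (encF-≢M k g x (proj₁ (·-injective (trans (sym (encT-dup fx fy)) eq))))
  encT-injective {suc (suc k)} e (dup-fits fx fy) (dup-fits fx′ fy′) eq =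
    let eqx , eqy = ·-injective (trans (sym (encT-dup fx fy)) (trans eq (encT-dup fx′ fy′))) in
    cong₂ (λ x y → black (x ++ y)) (encF-injective e fx fx′ eqx) (encF-injective e fy fy′ eqy)
  encT-injective {suc (suc k)} e (black-fits fx) (black-fits fx′) eq =
    cong black (encF-injective e fx fx′ (proj₁ (·-injective eq)))

  encF-injective : EncodableF k g → FitsF g x → FitsF g x′ → encF k g x ≡ encF k g x′ → x ≡ x′
  encF-injective _ [] [] _ = refl
  encF-injective {suc k} (e , e′) (fp ∷ fg) (fp′ ∷ fg′) eq =
    let eqp , eqg = ·-injective eq in
    cong₂ _∷_ (encT-injective {k} e fp fp′ eqp) (encF-injective e′ fg fg′ eqg)

encoding-iso : ∀ {k f} → EncodableF k f → OrderIso f (encF k f f) (top k)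
encoding-iso {k} {f} e = record
  { to      = λ { (x , p) → encF k f x , proj₂ (forward* ff p) , ≼top (fits p) }
  ; from    = λ { (t , p , _) → let x , q , _ = backward* ff p in x , q }
  ; to-from = λ { (t , p , _) → let _ , _ , _ , eq = backward* ff p in eq }
  ; from-to = λ { (x , p) →
      let y , _ , fy , eq = backward* ff (proj₂ (forward* ff p)) in
      encF-injective e fy (fits p) eq }
  ; to-mono = λ { (x , p) (y , q) x≪y → proj₂ (forward* (fits p) x≪y) }
  ; to-refl = λ { (x , p) (y , q) le →
      let z , x≪z , fz , eq = backward* (fits p) le in
      subst (x ≪_) (encF-injective e fz (fits q) eq) x≪z }
  }
  where
  open Simulation {_↝_ = _⇒D_} {_⇝_ = _⇒_} (FitsF f) (encF k f) (encF-forward e) (encF-backward e)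

  ff : FitsF f f
  ff = fitsF-refl f

  fits : ∀ {x} → f ≪ x → FitsF f x
  fits p = proj₁ (forward* ff p)

  ≼top : ∀ {x} → FitsF f x → encF k f x ≼ top k
  ≼top = Level⇒≼top ∘ encF-Level e

theorem2p6 : (f : DForest) →
    Σ ℕ (λ d → Σ Term (λ u → Σ Term (λ v →
      InM d u × IsGreatestM d v × OrderIso f u v)))
theorem2p6 f =
  let k , e = encodableF f in
  k , encF k f f , top k , Level⇒InM (encF-Level e (fitsF-refl f)) , top-greatest k , encoding-iso e
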